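{- Let $\mathcal{B}=(\mathcal{V},\mathcal{E})$ be a finite connected undirected graph with an action of a group $G$ by graph automorphisms, and let $\mathcal{W}$ be the set of $G$-pivot vertices of $\mathcal{B}$. Assume that $\mathcal{B}$ contains a vertex $v_0$ which is fixed by $G$. Then $|\mathcal{W}\setminus\{v_0\}|\leq \beta(\mathcal{B})$.
   Context: A finite undirected graph $\mathcal{B}$ has a finite vertex set $\mathcal{V}$ and an edge set $\mathcal{E}$ of $2$-element subsets of $\mathcal{V}$. A vertex $v$ is a $G$-pivot vertex if for every $w\in\mathcal{V}$ with $\{v,w\}\in\mathcal{E}$, the set $\{gw\mid g\in G,\ gv=v\}$ has even cardinality. The Betti number is $\beta(\mathcal{B})=|\mathcal{E}|-|\mathcal{V}|+1$. -}

module Defs where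

open import Level using (Level; _⊔_)
open import Data.Bool using (Bool; true; false)
open import Data.Nat using (ℕ; zero; suc; _+_)
open import Data.Nat.Divisibility using (_∣_)
open import Data.Fin using (Fin; _<_)
open import Data.Fin.Subset using (Subset; _∈_; ∣_∣)
open import Data.List using (List; length; filter)
open import Data.List using (allFin) renaming (concatMap to lconcatMap)
open import Data.List as L using ()
open import Data.Product using (Σ; _×_; ∃; ∃-syntax; _,_)
open import Data.Integer as ℤ using (ℤ; +_)
open import Function.Bundles using (_⇔_)
open import Algebra.Bundles using (Group)
open import Relation.Binary.PropositionalEquality using (_≡_)
open import Relation.Nullary using (¬_)

-- The edge set is the set of 2-element subsets {u,w} with adj u w ≡ true.
record Graph (n : ℕ) : Set where
  field
    adj   : Fin n → Fin n → Bool
    sym   : ∀ u w → adj u w ≡ adj w u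
    irrefl : ∀ u → adj u u ≡ false

open Graph public

Adj : ∀ {n} → Graph n → Fin n → Fin n → Set
Adj B u w = adj B u w ≡ true

data Walk {n : ℕ} (B : Graph n) : Fin n → Fin n → Set where
  here : ∀ {u} → Walk B u u
  step : ∀ {u v w} → Adj B u v → Walk B v w → Walk B u w

Connected : ∀ {n} → Graph n → Set
Connected B = ∀ u w → Walk B u w

-- number of edges: number of pairs (u , w) with u < w (as elements of Fin n)
-- that are adjacent; each 2-element subset {u,w} is counted exactly once.
allPairs : (n : ℕ) → List (Fin n × Fin n)
allPairs n = lconcatMap (λ u → L.map (λ w → (u , w)) (allFin n)) (allFin n)

countTrue : ∀ {A : Set} → (A → Bool) → List A → ℕ
countTrue f L.[] = 0
countTrue f (x L.∷ xs) with f x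
... | true  = suc (countTrue f xs)
... | false = countTrue f xs

open import Data.Fin using (_<?_)
open import Relation.Nullary.Decidable using (⌊_⌋)
open import Data.Bool using (_∧_)

numEdges : ∀ {n} → Graph n → ℕ
numEdges {n} B = countTrue (λ { (u , w) → ⌊ u <? w ⌋ ∧ adj B u w }) (allPairs n)

betti : ∀ {n} → Graph n → ℤ
betti {n} B = ((+ numEdges B) ℤ.- (+ n)) ℤ.+ (+ 1)

record AutAction {c ℓ : Level} (G : Group c ℓ) {n : ℕ} (B : Graph n) : Set (c ⊔ ℓ) where
  open Group G
  field
    act      : Carrier → Fin n → Fin n
    act-cong : ∀ {g h} → g ≈ h → ∀ u → act g u ≡ act h u
    act-ε    : ∀ u → act ε u ≡ u
    act-∙    : ∀ g h u → act (g ∙ h) u ≡ act g (act h u)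
    act-adj  : ∀ g u w → adj B (act g u) (act g w) ≡ adj B u w

open AutAction public

IsStabOrbit : ∀ {c ℓ} {G : Group c ℓ} {n} {B : Graph n} → AutAction G B →
              Fin n → Fin n → Subset n → Set c
IsStabOrbit {G = G} α v w S =
  ∀ u → (u ∈ S) ⇔ (∃[ g ] (act α g v ≡ v × act α g w ≡ u))

IsPivot : ∀ {c ℓ} {G : Group c ℓ} {n} {B : Graph n} → AutAction G B → Fin n → Set c
IsPivot {B = B} α v =
  ∀ w → Adj B v w → ∃[ S ] (IsStabOrbit α v w S × (2 ∣ ∣ S ∣))

module Submission where

-- Let d be the breadth-first distance from the fixed vertex v₀
-- (it exists because B is connected).  Call an edge {u,v} with d u < d v a
-- descent into v.  Every vertex v ≠ v₀ has a descent into it (a neighbour on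
-- a shortest walk).  If moreover v is a G-pivot and w is such a neighbour,
-- the orbit of w under the stabiliser of v has even size, so it contains
-- some u ≠ w; since G fixes v₀ it preserves d, hence {u,v} is a second
-- descent into v.  Each edge is a descent into at most one of its endpoints,
-- so summing over all vertices gives  (n - 1) + |W ∖ {v₀}| ≤ |E|, which is
-- the claim  |W ∖ {v₀}| ≤ |E| - n + 1 = β(B).

open import Defs hiding (sym)
open import Level using (Level)
open import Data.Bool using (Bool; true; false; _∧_)
open import Data.Bool.Properties using () renaming (_≟_ to _≟ᵇ_)
open import Data.Nat as ℕ using (ℕ; zero; suc; _+_; _*_; _≤_; _<_; z≤n; s≤s; _<?_)
open import Data.Nat.Properties as ℕ using (≤-refl; ≤-trans; +-monoʳ-≤; +-mono-≤; +-comm; +-identityʳ; <-asym; *-cancelˡ-≤; +-0-commutativeMonoid; module ≤-Reasoning)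
open import Data.Nat.Divisibility using (_∣_; ∣1⇒≡1)
open import Data.Fin using (Fin; zero; suc; punchOut)
open import Data.Fin.Properties using (any?; punchIn-punchOut) renaming (_≟_ to _≟ᶠ_; _<?_ to _<ᶠ?_; <-cmp to <ᶠ-cmp)
open import Data.Fin.Subset using (Subset; _∈_; _∉_; ∣_∣; _-_; _─_; ⁅_⁆; _⊆_)
open import Data.Fin.Subset.Properties using (_∈?_; x∈⁅x⁆; x∈⁅y⁆⇒x≡y; x∉⁅y⁆⇒x≢y; ∣⁅x⁆∣≡1; p⊆q⇒∣p∣≤∣q∣; p─q⊆p)
open import Data.Vec.Base using ([]; _∷_; here; there)
open import Data.Vec.Functional using (removeAt)
open import Data.List.Base as List using (List; _++_; tabulate; concatMap)
open import Data.Product using (_×_; _,_; ∃-syntax; Σ; proj₁; proj₂)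
open import Data.Sum using (_⊎_; inj₁; inj₂)
open import Data.Empty using (⊥-elim)
open import Data.Integer as ℤ using (+_; +≤+)
open import Data.Integer.Properties using (pos-+; +-monoˡ-≤; ≤-reflexive) renaming (≤-trans to ≤ℤ-trans)
open import Data.Integer.Solver using (module +-*-Solver)
open import Relation.Binary using (tri<; tri≈; tri>)
open import Relation.Binary.PropositionalEquality
open import Relation.Nullary using (¬_; Dec; yes; no)
open import Relation.Nullary.Decidable using (⌊_⌋; does; _×-dec_; _⊎-dec_; ¬?)
open import Function.Bundles using (_⇔_; Equivalence)
open import Algebra.Bundles using (Group)
open import Algebra.Properties.CommutativeMonoid.Sum +-0-commutativeMonoid using (sum; sum-syntax; sum-remove; ∑-distrib-+; ∑-comm; sum-cong-≗)

bit : Bool → ℕ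
bit true  = 1
bit false = 0

∑-mono-≤ : ∀ {n} {f g : Fin n → ℕ} → (∀ i → f i ≤ g i) → sum f ≤ sum g
∑-mono-≤ {zero}  f≤g = z≤n
∑-mono-≤ {suc n} f≤g = +-mono-≤ (f≤g zero) (∑-mono-≤ (λ i → f≤g (suc i)))

∑-one : ∀ n → ∑[ i < n ] 1 ≡ n
∑-one zero    = refl
∑-one (suc n) = cong suc (∑-one n)

term≤∑ : ∀ {n} (f : Fin n → ℕ) i → f i ≤ sum f
term≤∑ {suc n} f i = begin
  f i                          ≤⟨ ℕ.m≤m+n (f i) _ ⟩
  f i + sum (removeAt f i)     ≡⟨ sum-remove f ⟨
  sum f                        ∎
  where open ≤-Reasoning

two-terms≤∑ : ∀ {n} (f : Fin n → ℕ) {i j} → i ≢ j → f i + f j ≤ sum f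
two-terms≤∑ {suc n} f {i} {j} i≢j = begin
  f i + f j                                  ≡⟨ cong (λ k → f i + f k) (punchIn-punchOut i≢j) ⟨
  f i + removeAt f i (punchOut i≢j)          ≤⟨ +-monoʳ-≤ (f i) (term≤∑ (removeAt f i) _) ⟩
  f i + sum (removeAt f i)                   ≡⟨ sum-remove f ⟨
  sum f                                      ∎
  where open ≤-Reasoning

∑∑ : ∀ {n} → (Fin n → Fin n → ℕ) → ℕ
∑∑ {n} f = ∑[ u < n ] ∑[ w < n ] f u w

∑∑-symmetrise : ∀ {n} (f : Fin n → Fin n → ℕ) →
                ∑∑ (λ u w → f u w + f w u) ≡ 2 * ∑∑ f
∑∑-symmetrise {n} f = begin
  ∑∑ (λ u w → f u w + f w u)                                ≡⟨ sum-cong-≗ (λ u → ∑-distrib-+ (f u) (λ w → f w u)) ⟩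
  ∑[ u < n ] (∑[ w < n ] f u w + ∑[ w < n ] f w u)          ≡⟨ ∑-distrib-+ (λ u → ∑[ w < n ] f u w) (λ u → ∑[ w < n ] f w u) ⟩
  ∑∑ f + ∑[ u < n ] ∑[ w < n ] f w u                        ≡⟨ cong (λ s → ∑∑ f + s) (∑-comm (λ w u → f w u)) ⟨
  ∑∑ f + ∑∑ f                                               ≡⟨ cong (λ s → ∑∑ f + s) (+-identityʳ (∑∑ f)) ⟨
  2 * ∑∑ f                                                  ∎
  where open ≡-Reasoning

∑∑-pairwise-≤ : ∀ {n} (f g : Fin n → Fin n → ℕ) →
                (∀ u w → f u w + f w u ≤ g u w + g w u) → ∑∑ f ≤ ∑∑ g
∑∑-pairwise-≤ f g f≤g = *-cancelˡ-≤ 2 (begin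
  2 * ∑∑ f                    ≡⟨ ∑∑-symmetrise f ⟨
  ∑∑ (λ u w → f u w + f w u)  ≤⟨ ∑-mono-≤ (λ u → ∑-mono-≤ (f≤g u)) ⟩
  ∑∑ (λ u w → g u w + g w u)  ≡⟨ ∑∑-symmetrise g ⟩
  2 * ∑∑ g                    ∎)
  where open ≤-Reasoning

countTrue-∷ : ∀ {A : Set} (p : A → Bool) x xs → countTrue p (x List.∷ xs) ≡ bit (p x) + countTrue p xs
countTrue-∷ p x xs with p x
... | true  = refl
... | false = refl

countTrue-++ : ∀ {A : Set} (p : A → Bool) xs ys → countTrue p (xs ++ ys) ≡ countTrue p xs + countTrue p ys
countTrue-++ p List.[]         ys = refl
countTrue-++ p (x List.∷ xs) ys = begin
  countTrue p (x List.∷ (xs ++ ys))              ≡⟨ countTrue-∷ p x (xs ++ ys) ⟩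
  bit (p x) + countTrue p (xs ++ ys)             ≡⟨ cong (λ c → bit (p x) + c) (countTrue-++ p xs ys) ⟩
  bit (p x) + (countTrue p xs + countTrue p ys)  ≡⟨ ℕ.+-assoc (bit (p x)) _ _ ⟨
  (bit (p x) + countTrue p xs) + countTrue p ys  ≡⟨ cong (_+ countTrue p ys) (countTrue-∷ p x xs) ⟨
  countTrue p (x List.∷ xs) + countTrue p ys     ∎
  where open ≡-Reasoning

countTrue-map-tabulate : ∀ {A B : Set} (p : B → Bool) (k : A → B) {n} (g : Fin n → A) →
                         countTrue p (List.map k (tabulate g)) ≡ ∑[ i < n ] bit (p (k (g i)))
countTrue-map-tabulate p k {zero}  g = refl
countTrue-map-tabulate p k {suc n} g =
  trans (countTrue-∷ p (k (g zero)) _) (cong (λ s → bit (p (k (g zero))) + s) (countTrue-map-tabulate p k (λ i → g (suc i))))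

countTrue-concatMap-tabulate : ∀ {A B : Set} (p : B → Bool) (h : A → List B) {n} (g : Fin n → A) →
                               countTrue p (concatMap h (tabulate g)) ≡ ∑[ i < n ] countTrue p (h (g i))
countTrue-concatMap-tabulate p h {zero}  g = refl
countTrue-concatMap-tabulate p h {suc n} g =
  trans (countTrue-++ p (h (g zero)) _) (cong (λ s → countTrue p (h (g zero)) + s) (countTrue-concatMap-tabulate p h (λ i → g (suc i))))

isEdgeUp : ∀ {n} → Graph n → Fin n → Fin n → ℕ
isEdgeUp B u w = bit (⌊ u <ᶠ? w ⌋ ∧ adj B u w)

numEdges≡∑∑ : ∀ {n} (B : Graph n) → numEdges B ≡ ∑∑ (isEdgeUp B)
numEdges≡∑∑ {n} B = begin
  numEdges B                                            ≡⟨ countTrue-concatMap-tabulate edgeUp row (λ u → u) ⟩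
  ∑[ u < n ] countTrue edgeUp (row u)                   ≡⟨ sum-cong-≗ (λ u → countTrue-map-tabulate edgeUp (u ,_) (λ w → w)) ⟩
  ∑∑ (isEdgeUp B)                                       ∎
  where
  open ≡-Reasoning
  edgeUp : Fin n × Fin n → Bool
  edgeUp (u , w) = ⌊ u <ᶠ? w ⌋ ∧ adj B u w
  row : Fin n → List (Fin n × Fin n)
  row u = List.map (u ,_) (List.allFin n)

-- For d : Fin n → ℕ, an edge {u,v} with
-- d u < d v is a descent into v; every edge is a descent into at most one
-- of its endpoints, so there are at most |E| descents.

descent : ∀ {n} → Graph n → (Fin n → ℕ) → Fin n → Fin n → ℕ
descent B d u v = bit (adj B u v ∧ ⌊ d u <? d v ⌋)

descent≡1 : ∀ {n} (B : Graph n) (d : Fin n → ℕ) {u v} → Adj B u v → d u < d v → descent B d u v ≡ 1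
descent≡1 B d {u} {v} uv du<dv rewrite uv with d u <? d v
... | yes _   = refl
... | no ¬lt  = ⊥-elim (¬lt du<dv)

descent-pair≤edge : ∀ {n} (B : Graph n) (d : Fin n → ℕ) u w →
                    descent B d u w + descent B d w u ≤ bit (adj B u w)
descent-pair≤edge B d u w rewrite Graph.sym B w u with adj B u w | d u <? d w | d w <? d u
... | false | _        | _        = z≤n
... | true  | yes u<w  | yes w<u  = ⊥-elim (<-asym u<w w<u)
... | true  | yes _    | no _     = ≤-refl
... | true  | no _     | yes _    = ≤-refl
... | true  | no _     | no _     = z≤n

edge≤isEdgeUp-pair : ∀ {n} (B : Graph n) u w → bit (adj B u w) ≤ isEdgeUp B u w + isEdgeUp B w u
edge≤isEdgeUp-pair B u w rewrite Graph.sym B w u with u <ᶠ? w | w <ᶠ? u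
... | yes _   | _       = ℕ.m≤m+n _ _
... | no _    | yes _   = ℕ.m≤n+m _ _
... | no u≮w  | no w≮u  with <ᶠ-cmp u w
...   | tri< u<w _ _  = ⊥-elim (u≮w u<w)
...   | tri> _ _ w<u  = ⊥-elim (w≮u w<u)
...   | tri≈ _ refl _ rewrite Graph.irrefl B u = z≤n

∑∑descent≤numEdges : ∀ {n} (B : Graph n) (d : Fin n → ℕ) → ∑∑ (descent B d) ≤ numEdges B
∑∑descent≤numEdges B d = begin
  ∑∑ (descent B d)   ≤⟨ ∑∑-pairwise-≤ (descent B d) (isEdgeUp B)
                          (λ u w → ≤-trans (descent-pair≤edge B d u w) (edge≤isEdgeUp-pair B u w)) ⟩
  ∑∑ (isEdgeUp B)    ≡⟨ numEdges≡∑∑ B ⟨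
  numEdges B         ∎
  where open ≤-Reasoning

least-witness : {P : ℕ → Set} → (∀ k → Dec (P k)) → ∀ {k} → P k →
                Σ ℕ λ m → P m × (∀ j → P j → m ≤ j)
least-witness P? {zero}  p0 = 0 , p0 , λ _ _ → z≤n
least-witness P? {suc k} pk with P? 0
... | yes p0 = 0 , p0 , λ _ _ → z≤n
... | no ¬p0 with least-witness (λ j → P? (suc j)) pk
...   | m , pm , minimal = suc m , pm , λ { zero p0 → ⊥-elim (¬p0 p0) ; (suc j) pj → s≤s (minimal j pj) }

module Levels {n} (B : Graph n) (r : Fin n) where

  -- Reach k u : u is joined to r by a walk of length at most k.
  Reach : ℕ → Fin n → Set
  Reach zero    u = u ≡ r
  Reach (suc k) u = Reach k u ⊎ ∃[ w ] (Reach k w × Adj B w u)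

  reach? : ∀ k u → Dec (Reach k u)
  reach? zero    u = u ≟ᶠ r
  reach? (suc k) u = reach? k u ⊎-dec any? (λ w → reach? k w ×-dec (adj B w u ≟ᵇ true))

  walk⇒reach : ∀ {k a u} → Reach k a → Walk B a u → ∃[ m ] Reach m u
  walk⇒reach ra here            = _ , ra
  walk⇒reach ra (step au walk) = walk⇒reach (inj₂ (_ , ra , au)) walk

  reach-hom : (σ : Fin n → Fin n) → σ r ≡ r → (∀ {u w} → Adj B u w → Adj B (σ u) (σ w)) →
              ∀ {k u} → Reach k u → Reach k (σ u)
  reach-hom σ σr hom {zero}  refl                 = σr
  reach-hom σ σr hom {suc k} (inj₁ ru)            = inj₁ (reach-hom σ σr hom ru)
  reach-hom σ σr hom {suc k} (inj₂ (w , rw , wu)) = inj₂ (σ w , reach-hom σ σr hom rw , hom wu)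

  module _ (conn : Connected B) where

    level-spec : ∀ u → Σ ℕ λ m → Reach m u × (∀ j → Reach j u → m ≤ j)
    level-spec u = least-witness (λ k → reach? k u) (proj₂ (walk⇒reach {k = 0} refl (conn r u)))

    level : Fin n → ℕ
    level u = proj₁ (level-spec u)

    level-minimal : ∀ {j u} → Reach j u → level u ≤ j
    level-minimal {j} {u} = proj₂ (proj₂ (level-spec u)) j

    level-hom : (σ : Fin n → Fin n) → σ r ≡ r → (∀ {u w} → Adj B u w → Adj B (σ u) (σ w)) →
                ∀ u → level (σ u) ≤ level u
    level-hom σ σr hom u = level-minimal (reach-hom σ σr hom (proj₁ (proj₂ (level-spec u))))

    closer-neighbour-at : ∀ {v m} → Reach m v → (∀ j → Reach j v → m ≤ j) → v ≢ r →
                          ∃[ w ] (Adj B w v × level w < m)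
    closer-neighbour-at {m = zero}  v≡r               _       v≢r = ⊥-elim (v≢r v≡r)
    closer-neighbour-at {m = suc k} (inj₁ rv)         minimal _   = ⊥-elim (ℕ.n≮n k (minimal k rv))
    closer-neighbour-at {m = suc k} (inj₂ (w , rw , wv)) _    _   = w , wv , s≤s (level-minimal rw)

    closer-neighbour : ∀ v → v ≢ r → ∃[ w ] (Adj B w v × level w < level v)
    closer-neighbour v = closer-neighbour-at (proj₁ (proj₂ (level-spec v))) (proj₂ (proj₂ (level-spec v)))

∣p∣≡∑ : ∀ {n} (p : Subset n) → ∣ p ∣ ≡ ∑[ i < n ] bit (does (i ∈? p))
∣p∣≡∑ []                  = refl
∣p∣≡∑ {suc n} (true  ∷ p) = cong suc (∣p∣≡∑ {n} p)
∣p∣≡∑ {suc n} (false ∷ p) = ∣p∣≡∑ {n} p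

∈─⇒∉ : ∀ {n} (p q : Subset n) {x} → x ∈ p ─ q → x ∉ q
∈─⇒∉ (_ ∷ p) (true ∷ q) ()           here
∈─⇒∉ (_ ∷ p) (_    ∷ q) (there x∈p─q) (there x∈q) = ∈─⇒∉ p q x∈p─q x∈q

even-other : ∀ {n} (S : Subset n) {x} → x ∈ S → 2 ∣ ∣ S ∣ → ∃[ y ] (y ∈ S × y ≢ x)
even-other S {x} x∈S 2∣∣S∣ with any? (λ y → (y ∈? S) ×-dec ¬? (y ≟ᶠ x))
... | yes found = found
... | no none   = ⊥-elim (2∤1 (subst (2 ∣_) ∣S∣≡1 2∣∣S∣))
  where
  S⊆⁅x⁆ : S ⊆ ⁅ x ⁆
  S⊆⁅x⁆ {y} y∈S with y ≟ᶠ x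
  ... | yes refl = x∈⁅x⁆ x
  ... | no y≢x   = ⊥-elim (none (y , y∈S , y≢x))
  ⁅x⁆⊆S : ⁅ x ⁆ ⊆ S
  ⁅x⁆⊆S y∈⁅x⁆ = subst (_∈ S) (sym (x∈⁅y⁆⇒x≡y x y∈⁅x⁆)) x∈S
  ∣S∣≡1 : ∣ S ∣ ≡ 1
  ∣S∣≡1 = trans (ℕ.≤-antisym (p⊆q⇒∣p∣≤∣q∣ S⊆⁅x⁆) (p⊆q⇒∣p∣≤∣q∣ ⁅x⁆⊆S)) (∣⁅x⁆∣≡1 x)
  2∤1 : ¬ 2 ∣ 1
  2∤1 2∣1 with ∣1⇒≡1 2∣1
  ... | ()

module PivotCounting {c ℓ : Level} (G : Group c ℓ) {n} (B : Graph n) (conn : Connected B)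
                     (α : AutAction G B) (v₀ : Fin n) (fixed : ∀ g → act α g v₀ ≡ v₀) where

  open Group G using (ε)
  open Levels B v₀ using (level; level-hom; closer-neighbour)

  adj-sym : ∀ {u w} → Adj B u w → Adj B w u
  adj-sym {u} {w} uw = trans (Graph.sym B w u) uw

  parents : Fin n → ℕ
  parents v = ∑[ u < n ] descent B (level conn) u v

  -- Group elements are root-fixing automorphisms, so they preserve levels.
  level-act : ∀ g u → level conn (act α g u) ≤ level conn u
  level-act g = level-hom conn (act α g) (fixed g) (λ {u} {w} uw → trans (act-adj α g u w) uw)

  has-parent : ∀ v → v ≢ v₀ → 1 ≤ parents v
  has-parent v v≢v₀ with closer-neighbour conn v v≢v₀
  ... | w , wv , lw<lv =
    subst (_≤ parents v) (descent≡1 B (level conn) wv lw<lv) (term≤∑ (λ u → descent B (level conn) u v) w)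

  -- If w gives a descent into a pivot v, the stabiliser orbit of w, having
  -- even size, contains some u ≠ w, and u gives another descent into v.
  second-descent : ∀ {v w} → IsPivot α v → Adj B w v → level conn w < level conn v →
                   ∃[ u ] (u ≢ w × Adj B u v × level conn u < level conn v)
  second-descent {v} {w} pivot wv lw<lv with pivot w (adj-sym wv)
  ... | S , orbit , even with even-other S (Equivalence.from (orbit w) (ε , act-ε α v , act-ε α w)) even
  ...   | u , u∈S , u≢w with Equivalence.to (orbit u) u∈S
  ...     | g , gv≡v , gw≡u = u , u≢w , uv , lu<lv
    where
    uv : Adj B u v
    uv = subst₂ (Adj B) gw≡u gv≡v (trans (act-adj α g w v) wv)
    lu<lv : level conn u < level conn v
    lu<lv = ≤-trans (s≤s (subst (λ z → level conn z ≤ level conn w) gw≡u (level-act g w))) lw<lv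

  pivot-has-two-parents : ∀ v → v ≢ v₀ → IsPivot α v → 2 ≤ parents v
  pivot-has-two-parents v v≢v₀ pivot with closer-neighbour conn v v≢v₀
  ... | w , wv , lw<lv with second-descent pivot wv lw<lv
  ...   | u , u≢w , uv , lu<lv =
    subst₂ (λ a b → a + b ≤ parents v) (descent≡1 B (level conn) wv lw<lv) (descent≡1 B (level conn) uv lu<lv)
           (two-terms≤∑ (λ x → descent B (level conn) x v) (λ w≡u → u≢w (sym w≡u)))

  module _ (W : Subset n) (W-pivots : ∀ v → v ∈ W → IsPivot α v) where

    vertex-bound : ∀ v → 1 + bit (does (v ∈? W - v₀)) ≤ parents v + bit (does (v ∈? ⁅ v₀ ⁆))
    vertex-bound v with v ∈? ⁅ v₀ ⁆ | v ∈? W - v₀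
    ... | yes v∈⁅v₀⁆ | yes v∈W-v₀ = ⊥-elim (∈─⇒∉ W ⁅ v₀ ⁆ v∈W-v₀ v∈⁅v₀⁆)
    ... | yes _       | no _        = ℕ.m≤n+m 1 (parents v)
    ... | no v∉⁅v₀⁆  | yes v∈W-v₀ rewrite +-identityʳ (parents v) =
      pivot-has-two-parents v (x∉⁅y⁆⇒x≢y v∉⁅v₀⁆) (W-pivots v (p─q⊆p W ⁅ v₀ ⁆ v∈W-v₀))
    ... | no v∉⁅v₀⁆  | no _ rewrite +-identityʳ (parents v) = has-parent v (x∉⁅y⁆⇒x≢y v∉⁅v₀⁆)

    pivot-bound : ∣ W - v₀ ∣ + n ≤ numEdges B + 1
    pivot-bound = begin
      ∣ W - v₀ ∣ + n                                           ≡⟨ +-comm ∣ W - v₀ ∣ n ⟩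
      n + ∣ W - v₀ ∣                                           ≡⟨ cong₂ _+_ (sym (∑-one n)) (∣p∣≡∑ (W - v₀)) ⟩
      ∑[ v < n ] 1 + ∑[ v < n ] bit (does (v ∈? W - v₀))      ≡⟨ ∑-distrib-+ (λ _ → 1) (λ v → bit (does (v ∈? W - v₀))) ⟨
      ∑[ v < n ] (1 + bit (does (v ∈? W - v₀)))               ≤⟨ ∑-mono-≤ vertex-bound ⟩
      ∑[ v < n ] (parents v + bit (does (v ∈? ⁅ v₀ ⁆)))       ≡⟨ ∑-distrib-+ parents (λ v → bit (does (v ∈? ⁅ v₀ ⁆))) ⟩
      ∑[ v < n ] parents v + ∑[ v < n ] bit (does (v ∈? ⁅ v₀ ⁆))
                      ≡⟨ cong₂ _+_ (∑-comm (λ v u → descent B (level conn) u v)) (trans (sym (∣p∣≡∑ ⁅ v₀ ⁆)) (∣⁅x⁆∣≡1 v₀)) ⟩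
      ∑∑ (descent B (level conn)) + 1                          ≤⟨ ℕ.+-monoˡ-≤ 1 (∑∑descent≤numEdges B (level conn)) ⟩
      numEdges B + 1                                           ∎
      where open ≤-Reasoning

sub-bound : ∀ m n E → m + n ≤ E + 1 → + m ℤ.≤ (+ E ℤ.- + n) ℤ.+ + 1
sub-bound m n E h = ≤ℤ-trans (≤-reflexive (cancel (+ m) (+ n)))
  (≤ℤ-trans (+-monoˡ-≤ (ℤ.- + n) h′) (≤-reflexive (shuffle (+ E) (+ n))))
  where
  open +-*-Solver
  h′ : + m ℤ.+ + n ℤ.≤ + E ℤ.+ + 1
  h′ = subst₂ ℤ._≤_ (pos-+ m n) (pos-+ E 1) (+≤+ h)
  cancel : ∀ x y → x ≡ x ℤ.+ y ℤ.- y
  cancel = solve 2 (λ x y → x := x :+ y :- y) refl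
  shuffle : ∀ x y → x ℤ.+ + 1 ℤ.- y ≡ (x ℤ.- y) ℤ.+ + 1
  shuffle = solve 2 (λ x y → x :+ con (+ 1) :- y := (x :- y) :+ con (+ 1)) refl

lemma3p2 : ∀ {c ℓ : Level} (G : Group c ℓ) (n : ℕ) (B : Graph n) →
    Connected B → (α : AutAction G B) →
    (v₀ : Fin n) → (∀ g → act α g v₀ ≡ v₀) →
    (W : Subset n) → (∀ v → (v ∈ W) ⇔ IsPivot α v) →
    + ∣ W - v₀ ∣ ℤ.≤ betti B
lemma3p2 G n B conn α v₀ fixed W W⇔pivot =
  sub-bound ∣ W - v₀ ∣ n (numEdges B)
    (PivotCounting.pivot-bound G B conn α v₀ fixed W (λ v → Equivalence.to (W⇔pivot v)))
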